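{- Let $\mathbb F$ be a field of characteristic $0$ and let $r\ge1$, $1\le s<m$ be integers. If $K$ is an integer with $$K\ \ge\ \frac{m\binom{s+r}{s}+1}{m-s},$$ then there exists an $(s,r)$-elusive $K$-tuple of points in $\mathbb F^m$.
   Context: A $K$-tuple of points of $\mathbb F^m$ is $(s,r)$-elusive if for every polynomial mapping $\Gamma:\mathbb F^s\to\mathbb F^m$ whose components have degree at most $r$, the points of the tuple are not all contained in $\Gamma(\mathbb F^s)$. -}

module Defs where

open import Level using (Level; _⊔_) renaming (suc to lsuc)
open import Algebra.Bundles using (CommutativeRing)
open import Data.Nat as ℕ using (ℕ; zero; suc)
open import Data.Fin using (Fin)
open import Data.Product using (Σ; ∃; _×_; _,_; proj₁; proj₂)
open import Data.List using (List; []; _∷_)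
open import Data.List.Relation.Unary.All using (All)
open import Relation.Nullary using (¬_)

record Field (c ℓ : Level) : Set (lsuc (c ⊔ ℓ)) where
  field
    commutativeRing : CommutativeRing c ℓ
  open CommutativeRing commutativeRing public
  field
    1≉0     : ¬ (1# ≈ 0#)
    inverse : ∀ x → ¬ (x ≈ 0#) → ∃ λ y → x * y ≈ 1#

module _ {c ℓ : Level} (F : Field c ℓ) where
  open Field F

  fromℕ : ℕ → Carrier
  fromℕ zero    = 0#
  fromℕ (suc n) = 1# + fromℕ n

  CharZero : Set ℓ
  CharZero = ∀ n → ¬ (fromℕ (suc n) ≈ 0#)

  pow : Carrier → ℕ → Carrier
  pow x zero    = 1#
  pow x (suc n) = x * pow x n

totalDeg : ∀ {s} → (Fin s → ℕ) → ℕ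
totalDeg {zero}  e = 0
totalDeg {suc s} e = e Data.Fin.zero ℕ.+ totalDeg (λ i → e (Data.Fin.suc i))

module _ {c ℓ : Level} (F : Field c ℓ) where
  open Field F

  monomial : ∀ {s} → (Fin s → ℕ) → (Fin s → Carrier) → Carrier
  monomial {zero}  e x = 1#
  monomial {suc s} e x =
    pow F (x Data.Fin.zero) (e Data.Fin.zero)
      * monomial (λ i → e (Data.Fin.suc i)) (λ i → x (Data.Fin.suc i))

  Term : ℕ → Set c
  Term s = Carrier × (Fin s → ℕ)

  record Poly (s r : ℕ) : Set c where
    constructor mkPoly
    field
      terms  : List (Term s)
      degree : All (λ t → totalDeg (proj₂ t) ℕ.≤ r) terms

  evalTerms : ∀ {s} → List (Term s) → (Fin s → Carrier) → Carrier
  evalTerms []            x = 0#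
  evalTerms ((a , e) ∷ ts) x = a * monomial e x + evalTerms ts x

  eval : ∀ {s r} → Poly s r → (Fin s → Carrier) → Carrier
  eval p = evalTerms (Poly.terms p)

  PolyMap : (s r m : ℕ) → Set c
  PolyMap s r m = Fin m → Poly s r

  InImage : ∀ {s r m} → PolyMap s r m → (Fin m → Carrier) → Set (c ⊔ ℓ)
  InImage {s} Γ y = ∃ λ (x : Fin s → Carrier) → ∀ j → eval (Γ j) x ≈ y j

  Elusive : (s r : ℕ) {m K : ℕ} → (Fin K → Fin m → Carrier) → Set (c ⊔ ℓ)
  Elusive s r {m} P = ∀ (Γ : PolyMap s r m) → ¬ (∀ k → InImage Γ (P k))

module Submission where

-- Every K-tuple on the image of a polynomial map Γ : F^s → F^m of degree ≤ r is a
-- value of one universal polynomial map Φ : F^M → F^(K m), whose M = m μ + K s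
-- parameters are the coefficients of the μ = C(s + r, s) monomials in each component of
-- Γ and the preimages of the K points. The hypothesis on K says exactly M < K m. For
-- such Φ we construct a polynomial Q with integer coefficients that vanishes on the
-- image of Φ but not at some integer point β; read as a K-tuple, β is elusive.
-- Q is a combination of Lagrange basis polynomials of an integer grid in F^(K m), with
-- coefficients solving a homogeneous integer linear system (more unknowns than
-- equations) which makes Q ∘ Φ vanish on an integer grid in F^M; in characteristic 0 a
-- polynomial of small degree vanishing on that grid vanishes everywhere.

open import Defs
open import Level using (Level; _⊔_)
open import Algebra.Bundles using (CommutativeMonoid; CommutativeRing)
open import Data.Nat as ℕ using (ℕ; zero; suc)
import Data.Nat.Properties as ℕP
open import Data.Integer as ℤ using (ℤ; 0ℤ; 1ℤ)
import Data.Integer.Properties as ℤP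
open import Data.Fin as Fin using (Fin; toℕ)
import Data.Fin.Properties as FinP
open import Data.Product using (Σ; ∃; _,_; proj₁; proj₂)
open import Relation.Nullary using (¬_; yes; no)
open import Relation.Nullary.Negation using (contradiction)
open import Relation.Binary.PropositionalEquality as ≡ using (_≡_; _≢_; _≗_)
open import Function using (_∘_; const)

module SumFacts {c ℓ} (M : CommutativeMonoid c ℓ) where
  open import Data.Fin using (punchIn)
  open import Data.Vec.Functional using (Vector)
  open CommutativeMonoid M
  open import Algebra.Properties.CommutativeMonoid.Sum M using (sum; sum-remove; sum-cong-≋; sum-replicate-zero)

  sum-zero : ∀ {n} (f : Vector Carrier n) → (∀ i → f i ≈ ε) → sum f ≈ ε
  sum-zero {n} f f≈ε = trans (sum-cong-≋ f≈ε) (sum-replicate-zero n)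

  sum-single : ∀ {n} (f : Vector Carrier n) i → (∀ j → j ≢ i → f j ≈ ε) → sum f ≈ f i
  sum-single {suc n} f i others≈ε = begin
    sum f                         ≈⟨ sum-remove {i = i} f ⟩
    f i ∙ sum (f ∘ punchIn i)     ≈⟨ ∙-congˡ (sum-zero _ (λ j → others≈ε _ (FinP.punchInᵢ≢i i j))) ⟩
    f i ∙ ε                       ≈⟨ identityʳ (f i) ⟩
    f i                           ∎
    where open import Relation.Binary.Reasoning.Setoid setoid

module IntegerLinearAlgebra where
  open import Data.Fin using (punchIn; punchOut)
  open import Data.Integer using (_+_; _*_; -_; _-_)
  open import Data.Integer.Tactic.RingSolver using (solve-∀)
  open import Data.Sum using (inj₁; inj₂)
  open import Relation.Nullary.Decidable using (¬?; decidable-stable)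
  open import Algebra.Properties.Semiring.Sum ℤP.+-*-semiring public
    using (sum; ∑-distrib-+; *-distribˡ-sum; sum-cong-≋)
  open SumFacts ℤP.+-0-commutativeMonoid public using (sum-zero; sum-single)
  open ≡.≡-Reasoning

  _·_ : ∀ {n} → (Fin n → ℤ) → (Fin n → ℤ) → ℤ
  a · v = sum (λ u → a u * v u)

  record NonzeroSolution {e n} (A : Fin e → Fin n → ℤ) : Set where
    field
      solution : Fin n → ℤ
      support  : Fin n
      nonzero  : solution support ≢ 0ℤ
      solves   : ∀ i → A i · solution ≡ 0ℤ

  firstUnitVector : ∀ {e n} (A : Fin e → Fin (suc n) → ℤ) →
    (∀ i → A i Fin.zero ≡ 0ℤ) → NonzeroSolution A
  firstUnitVector A column≡0 = record
    { solution = unit ; support = Fin.zero ; nonzero = λ () ; solves = solves }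
    where
    unit : Fin (suc _) → ℤ
    unit Fin.zero    = 1ℤ
    unit (Fin.suc _) = 0ℤ
    solves : ∀ i → A i · unit ≡ 0ℤ
    solves i = ≡.cong₂ _+_ (≡.trans (ℤP.*-identityʳ _) (column≡0 i))
                           (sum-zero _ (λ u → ℤP.*-zeroʳ (A i (Fin.suc u))))

  -- Eliminating the first unknown with the pivot row a: the row b becomes
  -- b ⟨a⟩, and a solution w of the reduced rows lifts to a solution
  -- extend a w of the original rows.
  _⟨_⟩ : ∀ {n} → (Fin (suc n) → ℤ) → (Fin (suc n) → ℤ) → Fin n → ℤ
  (b ⟨ a ⟩) u = b (Fin.suc u) * a Fin.zero - b Fin.zero * a (Fin.suc u)

  extend : ∀ {n} → (Fin (suc n) → ℤ) → (Fin n → ℤ) → Fin (suc n) → ℤ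
  extend a w Fin.zero    = - ((a ∘ Fin.suc) · w)
  extend a w (Fin.suc u) = a Fin.zero * w u

  extend-correct : ∀ {n} (a b : Fin (suc n) → ℤ) (w : Fin n → ℤ) →
    b · extend a w ≡ (b ⟨ a ⟩) · w
  extend-correct a b w = begin
      b0 * (- S) + T
    ≡⟨ ≡.cong (_+ T) (moveNeg b0 S) ⟩
      (- b0) * S + T
    ≡⟨ ≡.cong (_+ T) (*-distribˡ-sum (- b0) (λ u → a (Fin.suc u) * w u)) ⟩
      sum (λ u → - b0 * (a (Fin.suc u) * w u)) + T
    ≡⟨ ℤP.+-comm _ T ⟩
      T + sum (λ u → - b0 * (a (Fin.suc u) * w u))
    ≡⟨ ∑-distrib-+ (λ u → b (Fin.suc u) * (a0 * w u)) (λ u → - b0 * (a (Fin.suc u) * w u)) ⟨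
      sum (λ u → b (Fin.suc u) * (a0 * w u) + - b0 * (a (Fin.suc u) * w u))
    ≡⟨ sum-cong-≋ (λ u → regroup b0 a0 (b (Fin.suc u)) (a (Fin.suc u)) (w u)) ⟩
      (b ⟨ a ⟩) · w
    ∎
    where
    a0 b0 S T : ℤ
    a0 = a Fin.zero
    b0 = b Fin.zero
    S = (a ∘ Fin.suc) · w
    T = sum (λ u → b (Fin.suc u) * (a0 * w u))
    moveNeg : ∀ x y → x * (- y) ≡ (- x) * y
    moveNeg = solve-∀
    regroup : ∀ b0 a0 bu au wu → bu * (a0 * wu) + - b0 * (au * wu) ≡ (bu * a0 - b0 * au) * wu
    regroup = solve-∀

  self-elimination : ∀ {n} (a : Fin (suc n) → ℤ) (w : Fin n → ℤ) → (a ⟨ a ⟩) · w ≡ 0ℤ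
  self-elimination a w = sum-zero _ λ u →
    ≡.trans (≡.cong (_* w u) (cancel (a (Fin.suc u)) (a Fin.zero))) (ℤP.*-zeroˡ (w u))
    where
    cancel : ∀ x y → x * y - y * x ≡ 0ℤ
    cancel = solve-∀

  nonzero-* : ∀ {x y} → x ≢ 0ℤ → y ≢ 0ℤ → x * y ≢ 0ℤ
  nonzero-* {x} x≢0 y≢0 xy≡0 with ℤP.i*j≡0⇒i≡0∨j≡0 x xy≡0
  ... | inj₁ x≡0 = x≢0 x≡0
  ... | inj₂ y≡0 = y≢0 y≡0

  -- If some row has a nonzero first entry, use it as pivot and solve the reduced
  -- system of e - 1 equations in n - 1 unknowns; otherwise take the first unit vector.
  underdetermined : ∀ {e n} → e ℕ.< n → (A : Fin e → Fin n → ℤ) → NonzeroSolution A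
  underdetermined {zero}  {suc n} _ A = firstUnitVector A (λ ())
  underdetermined {suc e} {suc n} (ℕ.s≤s e<n) A
    with FinP.any? (λ i → ¬? (A i Fin.zero ℤP.≟ 0ℤ))
  ... | no noPivot = firstUnitVector A (λ i → decidable-stable (A i Fin.zero ℤP.≟ 0ℤ) (λ ≢0 → noPivot (i , ≢0)))
  ... | yes (i , pivot≢0) = record
    { solution = extend a w
    ; support  = Fin.suc (NonzeroSolution.support reduced)
    ; nonzero  = nonzero-* pivot≢0 (NonzeroSolution.nonzero reduced)
    ; solves   = solves
    }
    where
    a : Fin (suc n) → ℤ
    a = A i
    reduced : NonzeroSolution (λ j → A (punchIn i j) ⟨ a ⟩)
    reduced = underdetermined e<n (λ j → A (punchIn i j) ⟨ a ⟩)
    w : Fin n → ℤ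
    w = NonzeroSolution.solution reduced
    solves : ∀ j → A j · extend a w ≡ 0ℤ
    solves j with j FinP.≟ i
    ... | yes ≡.refl = ≡.trans (extend-correct a a w) (self-elimination a w)
    ... | no j≢i = begin
      A j · extend a w                               ≡⟨ extend-correct a (A j) w ⟩
      (A j ⟨ a ⟩) · w                                ≡⟨ ≡.cong (λ k → (A k ⟨ a ⟩) · w) (FinP.punchIn-punchOut (j≢i ∘ ≡.sym)) ⟨
      (A (punchIn i (punchOut (j≢i ∘ ≡.sym))) ⟨ a ⟩) · w ≡⟨ NonzeroSolution.solves reduced _ ⟩
      0ℤ                                             ∎

module IntegersInField {c ℓ} (F : Field c ℓ) where
  open import Data.Integer using (+_; -[1+_])
  open Field F
  open import Algebra.Properties.Semiring.Mult semiring using (_×_; ×-homo-+; ×1-homo-*)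
  open import Algebra.Properties.Ring ring using (-‿distribˡ-*; -‿distribʳ-*; -0#≈0#; -‿involutive)
  open import Relation.Binary.Reasoning.Setoid setoid
  open import Algebra.Properties.AbelianGroup +-abelianGroup using (⁻¹-∙-comm)
  open import Algebra.Properties.CommutativeSemigroup +-commutativeSemigroup using (interchange)

  ι : ℤ → Carrier
  ι (+ n)    = n × 1#
  ι -[1+ n ] = - (suc n × 1#)

  fromℕ≡× : ∀ n → fromℕ F n ≡ n × 1#
  fromℕ≡× zero    = ≡.refl
  fromℕ≡× (suc n) = ≡.cong (λ x → 1# + x) (fromℕ≡× n)

  ι-neg : ∀ z → ι (ℤ.- z) ≈ - ι z
  ι-neg (+ zero)  = sym -0#≈0#
  ι-neg (+ suc n) = refl
  ι-neg -[1+ n ]  = sym (-‿involutive _)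

  ι-⊖ : ∀ m n → ι (m ℤ.⊖ n) ≈ m × 1# - n × 1#
  ι-⊖ m zero = begin
    ι (m ℤ.⊖ 0)    ≡⟨ ≡.cong ι (ℤP.⊖-≥ {m} {0} ℕ.z≤n) ⟩
    m × 1#         ≈⟨ +-identityʳ (m × 1#) ⟨
    m × 1# + 0#    ≈⟨ +-congˡ -0#≈0# ⟨
    m × 1# - 0#    ∎
  ι-⊖ zero (suc n) = begin
    ι (0 ℤ.⊖ suc n)    ≡⟨ ≡.cong ι (ℤP.⊖-< {0} {suc n} (ℕ.s≤s ℕ.z≤n)) ⟩
    - (suc n × 1#)     ≈⟨ sym (+-identityˡ _) ⟩
    0# - suc n × 1#    ∎
  ι-⊖ (suc m) (suc n) = begin
    ι (suc m ℤ.⊖ suc n)            ≡⟨ ≡.cong ι (ℤP.[1+m]⊖[1+n]≡m⊖n m n) ⟩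
    ι (m ℤ.⊖ n)                    ≈⟨ ι-⊖ m n ⟩
    m × 1# - n × 1#                ≈⟨ cancelˡ 1# (m × 1#) (n × 1#) ⟨
    suc m × 1# - suc n × 1#        ∎
    where
    cancelˡ : ∀ x a b → (x + a) - (x + b) ≈ a - b
    cancelˡ x a b = begin
      (x + a) + - (x + b)    ≈⟨ +-congˡ (⁻¹-∙-comm x b) ⟨
      (x + a) + (- x + - b)  ≈⟨ interchange x a (- x) (- b) ⟩
      (x - x) + (a - b)      ≈⟨ +-congʳ (-‿inverseʳ x) ⟩
      0# + (a - b)           ≈⟨ +-identityˡ _ ⟩
      a - b                  ∎

  ι-+ : ∀ z w → ι (z ℤ.+ w) ≈ ι z + ι w
  ι-+ (+ m)    (+ n)    = ×-homo-+ 1# m n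
  ι-+ (+ m)    -[1+ n ] = ι-⊖ m (suc n)
  ι-+ -[1+ m ] (+ n)    = trans (ι-⊖ n (suc m)) (+-comm _ _)
  ι-+ -[1+ m ] -[1+ n ] = begin
    - (suc (suc (m ℕ.+ n)) × 1#)       ≡⟨ ≡.cong (λ k → - (suc k × 1#)) (≡.sym (ℕP.+-suc m n)) ⟩
    - ((suc m ℕ.+ suc n) × 1#)         ≈⟨ -‿cong (×-homo-+ 1# (suc m) (suc n)) ⟩
    - (suc m × 1# + suc n × 1#)        ≈⟨ ⁻¹-∙-comm _ _ ⟨
    - (suc m × 1#) + - (suc n × 1#)    ∎

  ι-* : ∀ z w → ι (z ℤ.* w) ≈ ι z * ι w
  ι-* (+ m) (+ n) = trans (reflexive (≡.cong ι (≡.sym (ℤP.pos-* m n)))) (×1-homo-* m n)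
  ι-* -[1+ m ] (+ n) = begin
    ι (ℤ.- (+ suc m) ℤ.* + n)     ≡⟨ ≡.cong ι (≡.sym (ℤP.neg-distribˡ-* (+ suc m) (+ n))) ⟩
    ι (ℤ.- (+ suc m ℤ.* + n))     ≈⟨ ι-neg (+ suc m ℤ.* + n) ⟩
    - ι (+ suc m ℤ.* + n)         ≈⟨ -‿cong (ι-* (+ suc m) (+ n)) ⟩
    - (suc m × 1# * n × 1#)       ≈⟨ -‿distribˡ-* _ _ ⟩
    - (suc m × 1#) * n × 1#       ∎
  ι-* (+ m) -[1+ n ] = begin
    ι (+ m ℤ.* ℤ.- (+ suc n))     ≡⟨ ≡.cong ι (≡.sym (ℤP.neg-distribʳ-* (+ m) (+ suc n))) ⟩
    ι (ℤ.- (+ m ℤ.* + suc n))     ≈⟨ ι-neg (+ m ℤ.* + suc n) ⟩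
    - ι (+ m ℤ.* + suc n)         ≈⟨ -‿cong (ι-* (+ m) (+ suc n)) ⟩
    - (m × 1# * suc n × 1#)       ≈⟨ -‿distribʳ-* _ _ ⟩
    m × 1# * - (suc n × 1#)       ∎
  ι-* -[1+ m ] -[1+ n ] = begin
    (suc m ℕ.* suc n) × 1#            ≈⟨ ×1-homo-* (suc m) (suc n) ⟩
    suc m × 1# * suc n × 1#           ≈⟨ -‿involutive _ ⟨
    - - (suc m × 1# * suc n × 1#)     ≈⟨ -‿cong (-‿distribˡ-* _ _) ⟩
    - (- (suc m × 1#) * suc n × 1#)   ≈⟨ -‿distribʳ-* _ _ ⟩
    - (suc m × 1#) * - (suc n × 1#)   ∎

  ι-nonzero : CharZero F → ∀ {z} → z ≢ 0ℤ → ¬ (ι z ≈ 0#)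
  ι-nonzero char0 {+ zero}   z≢0 _   = z≢0 ≡.refl
  ι-nonzero char0 {+ suc n}  _   ι≈0 = char0 n (trans (reflexive (fromℕ≡× (suc n))) ι≈0)
  ι-nonzero char0 { -[1+ n ]} _  ι≈0 =
    ι-nonzero char0 {+ suc n} (λ ()) (trans (sym (-‿involutive _)) (trans (-‿cong ι≈0) -0#≈0#))

module UnivariatePolynomials {c ℓ} (F : Field c ℓ) where
  open import Data.Product using (_×_)
  open import Data.Vec.Functional using (_∷_; updateAt)
  open Field F
  open IntegersInField F using (ι; ι-nonzero)
  open import Algebra.Properties.CommutativeSemigroup +-commutativeSemigroup using (interchange)
  open import Algebra.Properties.CommutativeSemigroup *-commutativeSemigroup using (x∙yz≈y∙xz)
  open import Relation.Binary.Reasoning.Setoid setoid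

  -- f is a polynomial function of degree ≤ E, witnessed in Horner form
  -- f t = k + t · g t with g of degree ≤ E - 1.
  Degree≤ : ℕ → (Carrier → Carrier) → Set (c ⊔ ℓ)
  Degree≤ zero    f = Σ Carrier λ k → ∀ t → f t ≈ k
  Degree≤ (suc E) f = Σ Carrier λ k → Σ (Carrier → Carrier) λ g →
    Degree≤ E g × (∀ t → f t ≈ k + t * g t)

  degree-cong : ∀ E {f f′} → Degree≤ E f → (∀ t → f t ≈ f′ t) → Degree≤ E f′
  degree-cong zero    (k , f≈k)           f≈f′ = k , λ t → trans (sym (f≈f′ t)) (f≈k t)
  degree-cong (suc E) (k , g , deg-g , f≈) f≈f′ = k , g , deg-g , λ t → trans (sym (f≈f′ t)) (f≈ t)

  degree-resp : ∀ E {f} → Degree≤ E f → ∀ {t t′} → t ≈ t′ → f t ≈ f t′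
  degree-resp zero    (k , f≈k)            {t} {t′} _    = trans (f≈k t) (sym (f≈k t′))
  degree-resp (suc E) (k , g , deg-g , f≈) {t} {t′} t≈t′ =
    trans (f≈ t) (trans (+-congˡ (*-cong t≈t′ (degree-resp E deg-g t≈t′))) (sym (f≈ t′)))

  degree-const : ∀ E k → Degree≤ E (const k)
  degree-const zero    k = k , λ _ → refl
  degree-const (suc E) k = k , const 0# , degree-const E 0# , λ t →
    sym (trans (+-congˡ (zeroʳ t)) (+-identityʳ k))

  degree-suc : ∀ E {f} → Degree≤ E f → Degree≤ (suc E) f
  degree-suc zero    (k , f≈k)            = k , const 0# , degree-const 0 0# , λ t →
    trans (f≈k t) (sym (trans (+-congˡ (zeroʳ t)) (+-identityʳ k)))
  degree-suc (suc E) (k , g , deg-g , f≈) = k , g , degree-suc E deg-g , f≈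

  degree-mono : ∀ {E E′ f} → E ℕ.≤ E′ → Degree≤ E f → Degree≤ E′ f
  degree-mono {zero}  {zero}   _           deg-f = deg-f
  degree-mono {zero}  {suc E′} _           deg-f = degree-suc E′ (degree-mono ℕ.z≤n deg-f)
  degree-mono {suc E} {suc E′} (ℕ.s≤s E≤E′) (k , g , deg-g , f≈) = k , g , degree-mono E≤E′ deg-g , f≈

  degree-id : Degree≤ 1 (λ t → t)
  degree-id = 0# , const 1# , degree-const 0 1# , λ t → sym (trans (+-identityˡ _) (*-identityʳ t))

  degree-x* : ∀ E {g} → Degree≤ E g → Degree≤ (suc E) (λ t → t * g t)
  degree-x* E {g} deg-g = 0# , g , deg-g , λ t → sym (+-identityˡ _)

  degree-+ : ∀ E {f g} → Degree≤ E f → Degree≤ E g → Degree≤ E (λ t → f t + g t)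
  degree-+ zero    (k , f≈k) (k′ , g≈k′) = k + k′ , λ t → +-cong (f≈k t) (g≈k′ t)
  degree-+ (suc E) {f} {g} (k , f′ , deg-f′ , f≈) (k′ , g′ , deg-g′ , g≈) =
    k + k′ , (λ t → f′ t + g′ t) , degree-+ E deg-f′ deg-g′ , λ t → begin
      f t + g t                          ≈⟨ +-cong (f≈ t) (g≈ t) ⟩
      (k + t * f′ t) + (k′ + t * g′ t)   ≈⟨ interchange _ _ _ _ ⟩
      (k + k′) + (t * f′ t + t * g′ t)   ≈⟨ +-congˡ (distribˡ t _ _) ⟨
      (k + k′) + t * (f′ t + g′ t)       ∎

  degree-scale : ∀ E k {f} → Degree≤ E f → Degree≤ E (λ t → k * f t)
  degree-scale zero    k (k′ , f≈k′) = k * k′ , λ t → *-congˡ (f≈k′ t)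
  degree-scale (suc E) k {f} (k′ , g , deg-g , f≈) = k * k′ , (λ t → k * g t) , degree-scale E k deg-g , λ t → begin
    k * f t                  ≈⟨ *-congˡ (f≈ t) ⟩
    k * (k′ + t * g t)       ≈⟨ distribˡ _ _ _ ⟩
    k * k′ + k * (t * g t)   ≈⟨ +-congˡ (x∙yz≈y∙xz k t (g t)) ⟩
    k * k′ + t * (k * g t)   ∎

  degree-* : ∀ E₁ E₂ {f g} → Degree≤ E₁ f → Degree≤ E₂ g → Degree≤ (E₁ ℕ.+ E₂) (λ t → f t * g t)
  degree-* zero     E₂ (k , f≈k) deg-g = degree-cong E₂ (degree-scale E₂ k deg-g) λ t → *-congʳ (sym (f≈k t))
  degree-* (suc E₁) E₂ {f} {g} (k , f′ , deg-f′ , f≈) deg-g =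
    degree-cong (suc (E₁ ℕ.+ E₂))
      (degree-+ (suc (E₁ ℕ.+ E₂))
        (degree-mono (ℕP.≤-trans (ℕP.m≤n+m E₂ E₁) (ℕP.n≤1+n _)) (degree-scale E₂ k deg-g))
        (degree-x* (E₁ ℕ.+ E₂) (degree-* E₁ E₂ deg-f′ deg-g)))
      λ t → begin
        k * g t + t * (f′ t * g t)   ≈⟨ +-congˡ (*-assoc _ _ _) ⟨
        k * g t + (t * f′ t) * g t   ≈⟨ distribʳ _ _ _ ⟨
        (k + t * f′ t) * g t         ≈⟨ *-congʳ (f≈ t) ⟨
        f t * g t                    ∎

  degree-shift : ∀ E {f} → Degree≤ E f → Degree≤ E (λ t → f (1# + t))
  degree-shift zero    (k , f≈k) = k , λ t → f≈k _
  degree-shift (suc E) {f} (k , g , deg-g , f≈) =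
    degree-cong (suc E)
      (degree-+ (suc E) (degree-suc E (degree-+ E (degree-const E k) deg-g₁)) (degree-x* E deg-g₁))
      λ t → begin
        (k + g (1# + t)) + t * g (1# + t)        ≈⟨ +-assoc _ _ _ ⟩
        k + (g (1# + t) + t * g (1# + t))        ≈⟨ +-congˡ (+-congʳ (*-identityˡ _)) ⟨
        k + (1# * g (1# + t) + t * g (1# + t))   ≈⟨ +-congˡ (distribʳ _ _ _) ⟨
        k + (1# + t) * g (1# + t)                ≈⟨ f≈ _ ⟨
        f (1# + t)                               ∎
    where deg-g₁ = degree-shift E deg-g

  cancel-nonzero : ∀ {x y} → ¬ (x ≈ 0#) → x * y ≈ 0# → y ≈ 0#
  cancel-nonzero {x} {y} x≉0 xy≈0 with inverse x x≉0
  ... | x⁻¹ , xx⁻¹≈1 = begin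
    y               ≈⟨ *-identityˡ y ⟨
    1# * y          ≈⟨ *-congʳ (trans (sym xx⁻¹≈1) (*-comm x x⁻¹)) ⟩
    (x⁻¹ * x) * y   ≈⟨ *-assoc x⁻¹ x y ⟩
    x⁻¹ * (x * y)   ≈⟨ *-congˡ xy≈0 ⟩
    x⁻¹ * 0#        ≈⟨ zeroʳ x⁻¹ ⟩
    0#              ∎

  point : ∀ {E} → Fin E → Carrier
  point a = ι (ℤ.+ toℕ a)

  -- If f t = k + t · g t vanishes there, then k = f 0 = 0 and (1 + a) · g (1 + a) = 0,
  -- so g (1 + t), of degree ≤ E - 1, vanishes at 0, …, E - 1 (using characteristic 0).
  vanish-on-points : CharZero F → ∀ E {f} → Degree≤ E f → (∀ (a : Fin (suc E)) → f (point a) ≈ 0#) → ∀ t → f t ≈ 0#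
  vanish-on-points char0 zero (k , f≈k) f0≈0 t = trans (f≈k t) (trans (sym (f≈k 0#)) (f0≈0 Fin.zero))
  vanish-on-points char0 (suc E) {f} (k , g , deg-g , f≈) fa≈0 t = begin
      f t             ≈⟨ f≈ t ⟩
      k + t * g t     ≈⟨ +-cong k≈0 (*-congˡ (g≈0 t)) ⟩
      0# + t * 0#     ≈⟨ +-identityˡ _ ⟩
      t * 0#          ≈⟨ zeroʳ t ⟩
      0#              ∎
    where
    k≈0 : k ≈ 0#
    k≈0 = begin
      k               ≈⟨ +-identityʳ k ⟨
      k + 0#          ≈⟨ +-congˡ (zeroˡ _) ⟨
      k + 0# * g 0#   ≈⟨ f≈ 0# ⟨
      f 0#            ≈⟨ fa≈0 Fin.zero ⟩
      0#              ∎
    shifted-vanishes : ∀ (a : Fin (suc E)) → g (1# + point a) ≈ 0#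
    shifted-vanishes a = cancel-nonzero (ι-nonzero char0 {ℤ.+ suc (toℕ a)} (λ ())) (begin
      point (Fin.suc a) * g (1# + point a)        ≈⟨ +-identityˡ _ ⟨
      0# + point (Fin.suc a) * g (1# + point a)   ≈⟨ +-congʳ k≈0 ⟨
      k + point (Fin.suc a) * g (1# + point a)    ≈⟨ f≈ _ ⟨
      f (point (Fin.suc a))                       ≈⟨ fa≈0 (Fin.suc a) ⟩
      0#                                          ∎)
    g≈0 : ∀ t → g t ≈ 0#
    g≈0 t = trans (degree-resp E deg-g (sym 1+[-1+t]≈t))
                  (vanish-on-points char0 E (degree-shift E deg-g) shifted-vanishes (- 1# + t))
      where
      1+[-1+t]≈t : 1# + (- 1# + t) ≈ t
      1+[-1+t]≈t = trans (sym (+-assoc _ _ _)) (trans (+-congʳ (-‿inverseʳ 1#)) (+-identityˡ t))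

  vanish-on-grid : CharZero F → ∀ E M (G : (Fin M → Carrier) → Carrier) →
    (∀ {y y′} → (∀ p → y p ≈ y′ p) → G y ≈ G y′) →
    (∀ i y → Degree≤ E (λ t → G (updateAt y i (const t)))) →
    (∀ (a : Fin M → Fin (suc E)) → G (point ∘ a) ≈ 0#) →
    ∀ y → G y ≈ 0#
  vanish-on-grid char0 E zero    G G-resp _         G-grid y = trans (G-resp (λ ())) (G-grid (λ ()))
  vanish-on-grid char0 E (suc M) G G-resp separate G-grid y =
      trans (G-resp λ { Fin.zero → refl ; (Fin.suc p) → refl })
            (vanish-on-points char0 E (separate Fin.zero y) first-coordinate-on-points (y Fin.zero))
    where
    slice-vanishes : ∀ (a : Fin (suc E)) z → G (point a ∷ z) ≈ 0#
    slice-vanishes a = vanish-on-grid char0 E M (λ z → G (point a ∷ z))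
      (λ z≈ → G-resp λ { Fin.zero → refl ; (Fin.suc p) → z≈ p })
      (λ i z → degree-cong E (separate (Fin.suc i) (point a ∷ z)) λ t →
         G-resp λ { Fin.zero → refl ; (Fin.suc p) → refl })
      (λ b → trans (G-resp λ { Fin.zero → refl ; (Fin.suc p) → refl }) (G-grid (a ∷ b)))
    first-coordinate-on-points : ∀ (a : Fin (suc E)) → G (updateAt y Fin.zero (const (point a))) ≈ 0#
    first-coordinate-on-points a =
      trans (G-resp λ { Fin.zero → refl ; (Fin.suc p) → refl }) (slice-vanishes a (y ∘ Fin.suc))

module Expressions where

  infixl 6 _⊕_
  infixl 7 _⊗_
  data Expr (V : ℕ) : Set where
    var     : Fin V → Expr V
    con     : ℤ → Expr V
    _⊕_ _⊗_ : Expr V → Expr V → Expr V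

  degree : ∀ {V} → Expr V → ℕ
  degree (var _)   = 1
  degree (con _)   = 0
  degree (e ⊕ e′) = degree e ℕ.⊔ degree e′
  degree (e ⊗ e′) = degree e ℕ.+ degree e′

  _[_] : ∀ {V W} → Expr V → (Fin V → Expr W) → Expr W
  var p    [ σ ] = σ p
  con z    [ σ ] = con z
  (e ⊕ e′) [ σ ] = e [ σ ] ⊕ e′ [ σ ]
  (e ⊗ e′) [ σ ] = e [ σ ] ⊗ e′ [ σ ]

  degree-[] : ∀ {V W} (e : Expr V) (σ : Fin V → Expr W) B →
    (∀ p → degree (σ p) ℕ.≤ B) → degree (e [ σ ]) ℕ.≤ degree e ℕ.* B
  degree-[] (var p)  σ B σ≤B = ≡.subst (degree (σ p) ℕ.≤_) (≡.sym (ℕP.+-identityʳ B)) (σ≤B p)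
  degree-[] (con z)  σ B σ≤B = ℕ.z≤n
  degree-[] (e ⊕ e′) σ B σ≤B = ℕP.⊔-lub
    (ℕP.≤-trans (degree-[] e σ B σ≤B) (ℕP.*-monoˡ-≤ B (ℕP.m≤m⊔n (degree e) (degree e′))))
    (ℕP.≤-trans (degree-[] e′ σ B σ≤B) (ℕP.*-monoˡ-≤ B (ℕP.m≤n⊔m (degree e) (degree e′))))
  degree-[] (e ⊗ e′) σ B σ≤B = ≡.subst (degree (e [ σ ]) ℕ.+ degree (e′ [ σ ]) ℕ.≤_) (≡.sym (ℕP.*-distribʳ-+ B (degree e) (degree e′)))
    (ℕP.+-mono-≤ (degree-[] e σ B σ≤B) (degree-[] e′ σ B σ≤B))

  sumE : ∀ {V n} → (Fin n → Expr V) → Expr V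
  sumE {n = zero}  f = con 0ℤ
  sumE {n = suc n} f = f Fin.zero ⊕ sumE (f ∘ Fin.suc)

  prodE : ∀ {V n} → (Fin n → Expr V) → Expr V
  prodE {n = zero}  f = con 1ℤ
  prodE {n = suc n} f = f Fin.zero ⊗ prodE (f ∘ Fin.suc)

  degree-sumE : ∀ {V n} (f : Fin n → Expr V) {B} → (∀ u → degree (f u) ℕ.≤ B) → degree (sumE f) ℕ.≤ B
  degree-sumE {n = zero}  f f≤B = ℕ.z≤n
  degree-sumE {n = suc n} f f≤B = ℕP.⊔-lub (f≤B Fin.zero) (degree-sumE (f ∘ Fin.suc) (f≤B ∘ Fin.suc))

  degree-prodE : ∀ {V n} (f : Fin n → Expr V) {B} → (∀ u → degree (f u) ℕ.≤ B) → degree (prodE f) ℕ.≤ n ℕ.* B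
  degree-prodE {n = zero}  f f≤B = ℕ.z≤n
  degree-prodE {n = suc n} f f≤B = ℕP.+-mono-≤ (f≤B Fin.zero) (degree-prodE (f ∘ Fin.suc) f≤B′)
    where f≤B′ = f≤B ∘ Fin.suc

  module Semantics {c ℓ} (R : CommutativeRing c ℓ) (κ : ℤ → CommutativeRing.Carrier R)
                   (κ-0 : CommutativeRing._≈_ R (κ 0ℤ) (CommutativeRing.0# R)) where
    open CommutativeRing R
    open import Algebra.Properties.Semiring.Sum semiring using (sum)

    ⟦_⟧ : ∀ {V} → Expr V → (Fin V → Carrier) → Carrier
    ⟦ var p ⟧    ρ = ρ p
    ⟦ con z ⟧    ρ = κ z
    ⟦ e ⊕ e′ ⟧ ρ = ⟦ e ⟧ ρ + ⟦ e′ ⟧ ρ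
    ⟦ e ⊗ e′ ⟧ ρ = ⟦ e ⟧ ρ * ⟦ e′ ⟧ ρ

    ⟦⟧-cong : ∀ {V} (e : Expr V) {ρ ρ′} → (∀ p → ρ p ≈ ρ′ p) → ⟦ e ⟧ ρ ≈ ⟦ e ⟧ ρ′
    ⟦⟧-cong (var p)  ρ≈ = ρ≈ p
    ⟦⟧-cong (con z)  ρ≈ = refl
    ⟦⟧-cong (e ⊕ e′) ρ≈ = +-cong (⟦⟧-cong e ρ≈) (⟦⟧-cong e′ ρ≈)
    ⟦⟧-cong (e ⊗ e′) ρ≈ = *-cong (⟦⟧-cong e ρ≈) (⟦⟧-cong e′ ρ≈)

    ⟦⟧-[] : ∀ {V W} (e : Expr V) (σ : Fin V → Expr W) ρ → ⟦ e [ σ ] ⟧ ρ ≡ ⟦ e ⟧ (λ p → ⟦ σ p ⟧ ρ)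
    ⟦⟧-[] (var p)  σ ρ = ≡.refl
    ⟦⟧-[] (con z)  σ ρ = ≡.refl
    ⟦⟧-[] (e ⊕ e′) σ ρ = ≡.cong₂ _+_ (⟦⟧-[] e σ ρ) (⟦⟧-[] e′ σ ρ)
    ⟦⟧-[] (e ⊗ e′) σ ρ = ≡.cong₂ _*_ (⟦⟧-[] e σ ρ) (⟦⟧-[] e′ σ ρ)

    ⟦sumE⟧ : ∀ {V n} (f : Fin n → Expr V) ρ → ⟦ sumE f ⟧ ρ ≈ sum (λ u → ⟦ f u ⟧ ρ)
    ⟦sumE⟧ {n = zero}  f ρ = κ-0
    ⟦sumE⟧ {n = suc n} f ρ = +-congˡ (⟦sumE⟧ (f ∘ Fin.suc) ρ)

  open Semantics ℤP.+-*-commutativeRing (λ z → z) ≡.refl public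
    renaming (⟦_⟧ to ⟦_⟧ℤ; ⟦⟧-cong to ⟦⟧ℤ-cong; ⟦⟧-[] to ⟦⟧ℤ-[]; ⟦sumE⟧ to ⟦sumE⟧ℤ)
    using ()

  ⟦prodE⟧ℤ-zero : ∀ {V n} (f : Fin n → Expr V) ρ u → ⟦ f u ⟧ℤ ρ ≡ 0ℤ → ⟦ prodE f ⟧ℤ ρ ≡ 0ℤ
  ⟦prodE⟧ℤ-zero f ρ Fin.zero    fu≡0 = ≡.cong (ℤ._* ⟦ prodE (f ∘ Fin.suc) ⟧ℤ ρ) fu≡0
  ⟦prodE⟧ℤ-zero f ρ (Fin.suc u) fu≡0 =
    ≡.trans (≡.cong (⟦ f Fin.zero ⟧ℤ ρ ℤ.*_) (⟦prodE⟧ℤ-zero (f ∘ Fin.suc) ρ u fu≡0)) (ℤP.*-zeroʳ (⟦ f Fin.zero ⟧ℤ ρ))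

  ⟦prodE⟧ℤ-nonzero : ∀ {V n} (f : Fin n → Expr V) ρ → (∀ u → ⟦ f u ⟧ℤ ρ ≢ 0ℤ) → ⟦ prodE f ⟧ℤ ρ ≢ 0ℤ
  ⟦prodE⟧ℤ-nonzero {n = zero}  f ρ _     ()
  ⟦prodE⟧ℤ-nonzero {n = suc n} f ρ f≢0 =
    IntegerLinearAlgebra.nonzero-* (f≢0 Fin.zero) (⟦prodE⟧ℤ-nonzero (f ∘ Fin.suc) ρ (f≢0 ∘ Fin.suc))

module FunctionCodes where
  open import Data.Fin using (combine; finToFun; funToFin)

  funToFin-cong : ∀ {m n} {f g : Fin m → Fin n} → f ≗ g → funToFin f ≡ funToFin g
  funToFin-cong {zero}  f≗g = ≡.refl
  funToFin-cong {suc m} f≗g = ≡.cong₂ combine (f≗g Fin.zero) (funToFin-cong (f≗g ∘ Fin.suc))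

  finToFun-injective : ∀ {m n} (u u′ : Fin (n ℕ.^ m)) → finToFun {n} {m} u ≗ finToFun u′ → u ≡ u′
  finToFun-injective {m} {n} u u′ same = begin
    u                                    ≡⟨ FinP.funToFin-finToFin {m} {n} u ⟨
    funToFin (finToFun {n} {m} u)        ≡⟨ funToFin-cong same ⟩
    funToFin (finToFun {n} {m} u′)       ≡⟨ FinP.funToFin-finToFin {m} {n} u′ ⟩
    u′                                   ∎
    where open ≡.≡-Reasoning

  finToFun-separates : ∀ {m n} (u u′ : Fin (n ℕ.^ m)) → u ≢ u′ →
    ∃ λ p → finToFun {n} {m} u p ≢ finToFun u′ p
  finToFun-separates {m} {n} u u′ u≢u′ with FinP.all? (λ p → finToFun u p FinP.≟ finToFun u′ p)
  ... | yes same  = contradiction (finToFun-injective u u′ same) u≢u′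
  ... | no differ = FinP.¬∀⟶∃¬ m _ (λ p → finToFun {n} {m} u p FinP.≟ finToFun u′ p) differ

module LagrangeBasis where
  open import Data.Integer using (+_)
  open import Data.Fin using (finToFun)
  open Expressions
  open IntegerLinearAlgebra using (sum; sum-single; nonzero-*)
  open FunctionCodes using (finToFun-separates)

  gridPoint : ∀ {N D} → (Fin N → Fin D) → Fin N → ℤ
  gridPoint β p = + toℕ (β p)

  factor : ∀ {V D} → Fin D → Fin D → Expr V → Expr V
  factor a b x with a FinP.≟ b
  ... | yes _ = con 1ℤ
  ... | no _  = x ⊕ con (ℤ.- + toℕ a)

  lagrange : ∀ {N D} → (Fin N → Fin D) → Expr N
  lagrange {D = D} β = prodE (λ p → prodE (λ (a : Fin D) → factor a (β p) (var p)))

  degree-factor : ∀ {V D} (a b : Fin D) (p : Fin V) → degree (factor a b (var p)) ℕ.≤ 1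
  degree-factor a b p with a FinP.≟ b
  ... | yes _ = ℕ.z≤n
  ... | no _  = ℕ.s≤s ℕ.z≤n

  degree-lagrange : ∀ {N D} (β : Fin N → Fin D) → degree (lagrange β) ℕ.≤ N ℕ.* D
  degree-lagrange {N} {D} β = ≡.subst (λ k → degree (lagrange β) ℕ.≤ N ℕ.* k) (ℕP.*-identityʳ D)
    (degree-prodE _ λ p → degree-prodE _ λ a → degree-factor a (β p) p)

  lagrange-other : ∀ {N D} (β β′ : Fin N → Fin D) p → β p ≢ β′ p →
    ⟦ lagrange β ⟧ℤ (gridPoint β′) ≡ 0ℤ
  lagrange-other β β′ p βp≢β′p =
    ⟦prodE⟧ℤ-zero _ _ p (⟦prodE⟧ℤ-zero _ _ (β′ p) factor-vanishes)
    where
    factor-vanishes : ⟦ factor (β′ p) (β p) (var p) ⟧ℤ (gridPoint β′) ≡ 0ℤ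
    factor-vanishes with β′ p FinP.≟ β p
    ... | yes β′p≡βp = contradiction (≡.sym β′p≡βp) βp≢β′p
    ... | no _       = ℤP.+-inverseʳ (+ toℕ (β′ p))

  lagrange-self : ∀ {N D} (β : Fin N → Fin D) → ⟦ lagrange β ⟧ℤ (gridPoint β) ≢ 0ℤ
  lagrange-self β = ⟦prodE⟧ℤ-nonzero _ _ λ p → ⟦prodE⟧ℤ-nonzero _ _ λ a → factor-nonzero a p
    where
    factor-nonzero : ∀ a p → ⟦ factor a (β p) (var p) ⟧ℤ (gridPoint β) ≢ 0ℤ
    factor-nonzero a p with a FinP.≟ β p
    ... | yes _   = λ ()
    ... | no a≢βp = λ βp-a≡0 → a≢βp (≡.sym (FinP.toℕ-injective
            (ℤP.+-injective (ℤP.i-j≡0⇒i≡j (+ toℕ (β p)) (+ toℕ a) βp-a≡0))))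

  combination : ∀ {N D} → (Fin (D ℕ.^ N) → ℤ) → Expr N
  combination {N} {D} v = sumE (λ u → con (v u) ⊗ lagrange (finToFun {D} {N} u))

  degree-combination : ∀ {N D} (v : Fin (D ℕ.^ N) → ℤ) → degree (combination {N} {D} v) ℕ.≤ N ℕ.* D
  degree-combination {N} {D} v = degree-sumE (λ u → con (v u) ⊗ lagrange (finToFun {D} {N} u))
    λ u → degree-lagrange (finToFun {D} {N} u)

  ⟦combination⟧ℤ : ∀ {N D} (v : Fin (D ℕ.^ N) → ℤ) ρ →
    ⟦ combination {N} {D} v ⟧ℤ ρ ≡ sum (λ u → v u ℤ.* ⟦ lagrange (finToFun {D} {N} u) ⟧ℤ ρ)
  ⟦combination⟧ℤ {N} {D} v = ⟦sumE⟧ℤ (λ u → con (v u) ⊗ lagrange (finToFun {D} {N} u))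

  -- at the grid point coded by u₀ only the term of u₀ survives, so the
  -- combination does not vanish there if v u₀ ≠ 0
  combination-nonzero : ∀ {N D} (v : Fin (D ℕ.^ N) → ℤ) u₀ → v u₀ ≢ 0ℤ →
    ⟦ combination {N} {D} v ⟧ℤ (gridPoint (finToFun u₀)) ≢ 0ℤ
  combination-nonzero {N} {D} v u₀ v≢0 = ≡.subst (_≢ 0ℤ) (≡.sym at-β₀) (nonzero-* v≢0 (lagrange-self β₀))
    where
    β₀ : Fin N → Fin D
    β₀ = finToFun u₀
    other-terms-vanish : ∀ u → u ≢ u₀ → v u ℤ.* ⟦ lagrange (finToFun u) ⟧ℤ (gridPoint β₀) ≡ 0ℤ
    other-terms-vanish u u≢u₀ = vanishing-term (finToFun-separates u u₀ u≢u₀)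
      where
      vanishing-term : ∃ (λ p → finToFun u p ≢ β₀ p) → v u ℤ.* ⟦ lagrange (finToFun u) ⟧ℤ (gridPoint β₀) ≡ 0ℤ
      vanishing-term (p , differ) =
        ≡.trans (≡.cong (v u ℤ.*_) (lagrange-other (finToFun u) β₀ p differ)) (ℤP.*-zeroʳ (v u))
    at-β₀ : ⟦ combination {N} {D} v ⟧ℤ (gridPoint β₀) ≡ v u₀ ℤ.* ⟦ lagrange β₀ ⟧ℤ (gridPoint β₀)
    at-β₀ = ≡.trans (⟦combination⟧ℤ v (gridPoint β₀)) (sum-single _ u₀ other-terms-vanish)

module ExpressionsInField {c ℓ} (F : Field c ℓ) where
  open import Data.Vec.Functional using (updateAt)
  open import Data.Vec.Functional.Properties using (updateAt-updates; updateAt-minimal)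
  open Field F
  open IntegersInField F
  open UnivariatePolynomials F
  open Expressions
  open Semantics commutativeRing ι refl public

  ⟦⟧ℤ-ι : ∀ {V} (e : Expr V) (ρ : Fin V → ℤ) → ι (⟦ e ⟧ℤ ρ) ≈ ⟦ e ⟧ (ι ∘ ρ)
  ⟦⟧ℤ-ι (var p)  ρ = refl
  ⟦⟧ℤ-ι (con z)  ρ = refl
  ⟦⟧ℤ-ι (e ⊕ e′) ρ = trans (ι-+ (⟦ e ⟧ℤ ρ) (⟦ e′ ⟧ℤ ρ)) (+-cong (⟦⟧ℤ-ι e ρ) (⟦⟧ℤ-ι e′ ρ))
  ⟦⟧ℤ-ι (e ⊗ e′) ρ = trans (ι-* (⟦ e ⟧ℤ ρ) (⟦ e′ ⟧ℤ ρ)) (*-cong (⟦⟧ℤ-ι e ρ) (⟦⟧ℤ-ι e′ ρ))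

  degree-in-one-variable : ∀ {V} (e : Expr V) i y →
    Degree≤ (degree e) (λ t → ⟦ e ⟧ (updateAt y i (const t)))
  degree-in-one-variable (var p) i y with p FinP.≟ i
  ... | yes ≡.refl = degree-cong 1 degree-id λ t → reflexive (≡.sym (updateAt-updates p y))
  ... | no p≢i     = degree-cong 1 (degree-const 1 (y p)) λ t → reflexive (≡.sym (updateAt-minimal p i y p≢i))
  degree-in-one-variable (con z)  i y = degree-const 0 (ι z)
  degree-in-one-variable (e ⊕ e′) i y = degree-+ (degree e ℕ.⊔ degree e′)
    (degree-mono (ℕP.m≤m⊔n (degree e) (degree e′)) (degree-in-one-variable e i y))
    (degree-mono (ℕP.m≤n⊔m (degree e) (degree e′)) (degree-in-one-variable e′ i y))
  degree-in-one-variable (e ⊗ e′) i y =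
    degree-* (degree e) (degree e′) (degree-in-one-variable e i y) (degree-in-one-variable e′ i y)

  vanish-everywhere : CharZero F → ∀ {M} E (e : Expr M) → degree e ℕ.≤ E →
    (∀ (a : Fin M → Fin (suc E)) → ⟦ e ⟧ (point ∘ a) ≈ 0#) → ∀ y → ⟦ e ⟧ y ≈ 0#
  vanish-everywhere char0 {M} E e deg≤E = vanish-on-grid char0 E M ⟦ e ⟧ (⟦⟧-cong e)
    (λ i y → degree-mono deg≤E (degree-in-one-variable e i y))

module Counting where
  open import Data.Nat using (_+_; _*_; _^_; _≤_; _<_; _∸_; >-nonZero)
  open import Data.Nat.Properties
  open import Data.Nat.Tactic.RingSolver using (solve-∀)
  open ≡ using (refl; cong)

  ^-distribʳ-* : ∀ a b n → (a * b) ^ n ≡ a ^ n * b ^ n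
  ^-distribʳ-* a b zero    = refl
  ^-distribʳ-* a b (suc n) rewrite ^-distribʳ-* a b n = swap a b (a ^ n) (b ^ n)
    where
    swap : ∀ a b x y → a * b * (x * y) ≡ a * x * (b * y)
    swap = solve-∀

  -- With D = 2 (L + 1)^M and M < N, the D^N grid points of F^N outnumber the
  -- (L D + 1)^M grid points of F^M.
  grid-sizes : ∀ L M N → M < N → suc (L * (2 * suc L ^ M)) ^ M < (2 * suc L ^ M) ^ N
  grid-sizes L M N M<N = begin-strict
      suc (L * D) ^ M        ≤⟨ ^-monoˡ-≤ M (+-monoˡ-≤ (L * D) 1≤D) ⟩
      (X * D) ^ M            ≡⟨ ^-distribʳ-* X D M ⟩
      X ^ M * D ^ M          <⟨ m<m+n (X ^ M * D ^ M) (*-mono-≤ Xᴹ>0 (m^n>0 D {{>-nonZero 1≤D}} M)) ⟩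
      X ^ M * D ^ M + X ^ M * D ^ M   ≡⟨ double (X ^ M) (D ^ M) ⟩
      D ^ suc M              ≤⟨ ^-monoʳ-≤ D {{>-nonZero 1≤D}} M<N ⟩
      D ^ N                  ∎
    where
    open ≤-Reasoning
    X D : ℕ
    X = suc L
    D = 2 * X ^ M
    Xᴹ>0 : 0 < X ^ M
    Xᴹ>0 = m^n>0 X M
    1≤D : 1 ≤ D
    1≤D = ≤-trans Xᴹ>0 (m≤m+n (X ^ M) _)
    double : ∀ x y → x * y + x * y ≡ 2 * x * y
    double = solve-∀

  -- The hypothesis m μ + 1 ≤ K (m - s) says that the universal parametrization
  -- has fewer parameters (m μ coefficients and K s preimage coordinates) than
  -- the K m coordinates of a K-tuple of points.
  parameters<coordinates : ∀ m s K μ → s < m → m * μ + 1 ≤ K * (m ∸ s) → m * μ + K * s < K * m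
  parameters<coordinates m s K μ s<m hyp = begin-strict
      m * μ + K * s          <⟨ +-monoˡ-< (K * s) (≤-reflexive (+-comm 1 (m * μ))) ⟩
      m * μ + 1 + K * s      ≤⟨ +-monoˡ-≤ (K * s) hyp ⟩
      K * (m ∸ s) + K * s    ≡⟨ *-distribˡ-+ K (m ∸ s) s ⟨
      K * (m ∸ s + s)        ≡⟨ cong (K *_) (m∸n+n≡m (<⇒≤ s<m)) ⟩
      K * m                  ∎
    where open ≤-Reasoning

-- Q is sought as a combination of Lagrange basis
-- polynomials of a grid in F^N; requiring Q ∘ Φ to vanish on a grid in F^M is
-- a homogeneous linear system with fewer equations than unknowns, and such a
-- Q ∘ Φ, having small degree, then vanishes everywhere.
module DimensionCounting {c ℓ} (F : Field c ℓ) (char0 : CharZero F) where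
  open import Data.Nat.Tactic.RingSolver using (solve-∀)
  open import Data.Fin using (finToFun; funToFin)
  open Field F
  open IntegersInField F using (ι; ι-nonzero)
  open UnivariatePolynomials F using (point)
  open Expressions
  open ExpressionsInField F
  open LagrangeBasis
  open IntegerLinearAlgebra

  record Annihilator {M N} (Φ : Fin N → Expr M) : Set (c ⊔ ℓ) where
    field
      size     : ℕ
      Q        : Expr N
      β        : Fin N → Fin size
      vanishes : ∀ y → ⟦ Q [ Φ ] ⟧ y ≈ 0#
      nonzero  : ¬ (⟦ Q ⟧ (point ∘ β) ≈ 0#)

  annihilator : ∀ {M N} B (Φ : Fin N → Expr M) → (∀ p → degree (Φ p) ℕ.≤ B) → M ℕ.< N → Annihilator Φ
  annihilator {M} {N} B Φ deg-Φ M<N = record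
    { size = D ; Q = Q ; β = β₀ ; vanishes = Q∘Φ-vanishes ; nonzero = Q-nonzero-at-β₀ }
    where
    L D E : ℕ
    L = N ℕ.* B
    D = 2 ℕ.* suc L ℕ.^ M
    E = L ℕ.* D

    -- unknowns: one coefficient for each point of the grid {0, …, D-1}^N;
    -- equations: Q ∘ Φ vanishes at each point of the grid {0, …, E}^M
    system : Fin (suc E ℕ.^ M) → Fin (D ℕ.^ N) → ℤ
    system q u = ⟦ lagrange (finToFun u) ⟧ℤ (λ p → ⟦ Φ p ⟧ℤ (gridPoint (finToFun q)))

    solution : NonzeroSolution system
    solution = underdetermined (Counting.grid-sizes L M N M<N) system
    open NonzeroSolution solution renaming (solution to v; support to u₀; nonzero to v-nonzero)
    Q : Expr N
    Q = combination {N} {D} v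
    β₀ : Fin N → Fin D
    β₀ = finToFun u₀

    degree-Q∘Φ : degree (Q [ Φ ]) ℕ.≤ E
    degree-Q∘Φ = ℕP.≤-trans (degree-[] Q Φ B deg-Φ)
      (ℕP.≤-trans (ℕP.*-monoˡ-≤ B (degree-combination {N} {D} v)) (ℕP.≤-reflexive (reorder N D B)))
      where
      reorder : ∀ x y z → x ℕ.* y ℕ.* z ≡ x ℕ.* z ℕ.* y
      reorder = solve-∀

    vanishes-on-grid-ℤ : ∀ a → ⟦ Q [ Φ ] ⟧ℤ (gridPoint a) ≡ 0ℤ
    vanishes-on-grid-ℤ a = begin
      ⟦ Q [ Φ ] ⟧ℤ (gridPoint a)                            ≡⟨ ⟦⟧ℤ-[] Q Φ (gridPoint a) ⟩
      ⟦ Q ⟧ℤ Φ[a]                                           ≡⟨ ⟦combination⟧ℤ {N} {D} v Φ[a] ⟩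
      sum (λ u → v u ℤ.* ⟦ lagrange (finToFun u) ⟧ℤ Φ[a])   ≡⟨ sum-cong-≋ equation ⟩
      system q · v                                          ≡⟨ solves q ⟩
      0ℤ                                                    ∎
      where
      open ≡.≡-Reasoning
      q : Fin (suc E ℕ.^ M)
      q = funToFin a
      Φ[a] : Fin N → ℤ
      Φ[a] p = ⟦ Φ p ⟧ℤ (gridPoint a)
      equation : ∀ u → v u ℤ.* ⟦ lagrange (finToFun u) ⟧ℤ Φ[a] ≡ system q u ℤ.* v u
      equation u = ≡.trans (ℤP.*-comm (v u) (⟦ lagrange (finToFun u) ⟧ℤ Φ[a])) (≡.cong (ℤ._* v u) (⟦⟧ℤ-cong (lagrange (finToFun u)) λ p →
        ⟦⟧ℤ-cong (Φ p) λ i → ≡.cong (ℤ.+_ ∘ Fin.toℕ) (≡.sym (FinP.finToFun-funToFin a i))))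

    vanishes-on-grid : ∀ a → ⟦ Q [ Φ ] ⟧ (point ∘ a) ≈ 0#
    vanishes-on-grid a = trans (sym (⟦⟧ℤ-ι (Q [ Φ ]) (gridPoint a))) (reflexive (≡.cong ι (vanishes-on-grid-ℤ a)))

    Q∘Φ-vanishes : ∀ y → ⟦ Q [ Φ ] ⟧ y ≈ 0#
    Q∘Φ-vanishes = vanish-everywhere char0 E (Q [ Φ ]) degree-Q∘Φ vanishes-on-grid

    Q-nonzero-at-β₀ : ¬ (⟦ Q ⟧ (point ∘ β₀) ≈ 0#)
    Q-nonzero-at-β₀ Q≈0 = ι-nonzero char0 (combination-nonzero {N} {D} v u₀ v-nonzero) (trans (⟦⟧ℤ-ι Q (gridPoint β₀)) Q≈0)

  not-in-image : ∀ {M N} {Φ : Fin N → Expr M} (A : Annihilator Φ) y →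
    ¬ (∀ p → ⟦ Φ p ⟧ y ≈ point (Annihilator.β A p))
  not-in-image {Φ = Φ} A y Φy≈β = nonzero (begin
      ⟦ Q ⟧ (point ∘ β)            ≈⟨ ⟦⟧-cong Q (λ p → sym (Φy≈β p)) ⟩
      ⟦ Q ⟧ (λ p → ⟦ Φ p ⟧ y)      ≡⟨ ⟦⟧-[] Q Φ y ⟨
      ⟦ Q [ Φ ] ⟧ y                ≈⟨ vanishes y ⟩
      0#                           ∎)
    where
    open Annihilator A
    open import Relation.Binary.Reasoning.Setoid setoid

module MonomialEnumeration where
  open import Data.Nat using (_+_; _≤_)
  open import Data.Nat.Combinatorics using (_C_; nCk+nC[k+1]≡[n+1]C[k+1]; nCn≡1)
  open import Data.Fin using (splitAt; _↑ˡ_; _↑ʳ_)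
  open import Data.Sum using (_⊎_; inj₁; inj₂)
  open import Data.Vec.Functional using (_∷_; head; tail)

  -- the number of monomials: those not involving the first variable, plus
  -- those divisible by it (i.e. of degree ≤ r - 1 after dividing)
  count : ℕ → ℕ → ℕ
  count zero    r       = 1
  count (suc s) zero    = count s zero
  count (suc s) (suc r) = count s (suc r) + count (suc s) r

  monomials : ∀ s r → Fin (count s r) → Fin s → ℕ
  monomials-split : ∀ s r → Fin (count s (suc r)) ⊎ Fin (count (suc s) r) → Fin (suc s) → ℕ

  monomials zero    r       i = λ ()
  monomials (suc s) zero    i = 0 ∷ monomials s zero i
  monomials (suc s) (suc r) i = monomials-split s r (splitAt (count s (suc r)) i)

  monomials-split s r (inj₁ j) = 0 ∷ monomials s (suc r) j
  monomials-split s r (inj₂ j) = suc (head e) ∷ tail e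
    where e = monomials (suc s) r j

  monomials-degree : ∀ s r i → totalDeg (monomials s r i) ≤ r
  monomials-degree zero    r       i = ℕ.z≤n
  monomials-degree (suc s) zero    i = monomials-degree s zero i
  monomials-degree (suc s) (suc r) i with splitAt (count s (suc r)) i
  ... | inj₁ j = monomials-degree s (suc r) j
  ... | inj₂ j = ℕ.s≤s (monomials-degree (suc s) r j)

  monomials-complete : ∀ s r (e : Fin s → ℕ) → totalDeg e ≤ r → Σ (Fin (count s r)) λ i → monomials s r i ≗ e
  monomials-complete-∷ : ∀ s r a (e : Fin s → ℕ) → a + totalDeg e ≤ r →
    Σ (Fin (count (suc s) r)) λ i → monomials (suc s) r i ≗ a ∷ e

  monomials-complete zero    r e _    = Fin.zero , λ ()
  monomials-complete (suc s) r e deg≤ with monomials-complete-∷ s r (head e) (tail e) deg≤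
  ... | i , found = i , λ { Fin.zero → found Fin.zero ; (Fin.suc j) → found (Fin.suc j) }

  monomials-complete-∷ s zero    zero    e deg≤ with monomials-complete s zero e deg≤
  ... | i , found = i , λ { Fin.zero → ≡.refl ; (Fin.suc j) → found j }
  monomials-complete-∷ s (suc r) zero    e deg≤ with monomials-complete s (suc r) e deg≤
  ... | i , found = i ↑ˡ count (suc s) r , λ j →
    ≡.trans (≡.cong (λ x → monomials-split s r x j) (FinP.splitAt-↑ˡ (count s (suc r)) i (count (suc s) r)))
            (cons-zero found j)
    where
    cons-zero : ∀ {e′} → monomials s (suc r) i ≗ e′ → (0 ∷ monomials s (suc r) i) ≗ (0 ∷ e′)
    cons-zero found Fin.zero    = ≡.refl
    cons-zero found (Fin.suc j) = found j
  monomials-complete-∷ s (suc r) (suc a) e (ℕ.s≤s deg≤) with monomials-complete-∷ s r a e deg≤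
  ... | i , found = count s (suc r) ↑ʳ i , λ j →
    ≡.trans (≡.cong (λ x → monomials-split s r x j) (FinP.splitAt-↑ʳ (count s (suc r)) (count (suc s) r) i))
            (raise found j)
    where
    raise : monomials (suc s) r i ≗ a ∷ e →
      (suc (monomials (suc s) r i Fin.zero) ∷ tail (monomials (suc s) r i)) ≗ (suc a ∷ e)
    raise found Fin.zero    = ≡.cong suc (found Fin.zero)
    raise found (Fin.suc j) = found (Fin.suc j)

  -- the recursion of count is Pascal's rule
  count≡binomial : ∀ s r → count s r ≡ (s + r) C s
  count≡binomial zero    r       = ≡.refl
  count≡binomial (suc s) zero    = begin
    count s zero           ≡⟨ count≡binomial s zero ⟩
    (s + 0) C s            ≡⟨ ≡.cong (_C s) (ℕP.+-identityʳ s) ⟩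
    s C s                  ≡⟨ nCn≡1 s ⟩
    1                      ≡⟨ nCn≡1 (suc s) ⟨
    suc s C suc s          ≡⟨ ≡.cong (_C suc s) (ℕP.+-identityʳ (suc s)) ⟨
    (suc s + 0) C suc s    ∎
    where open ≡.≡-Reasoning
  count≡binomial (suc s) (suc r) = begin
    count s (suc r) + count (suc s) r                ≡⟨ ≡.cong₂ _+_ (count≡binomial s (suc r)) (count≡binomial (suc s) r) ⟩
    (s + suc r) C s + (suc s + r) C suc s            ≡⟨ ≡.cong (λ n → (s + suc r) C s + n C suc s) (ℕP.+-suc s r) ⟨
    (s + suc r) C s + (s + suc r) C suc s            ≡⟨ nCk+nC[k+1]≡[n+1]C[k+1] (s + suc r) s ⟩
    suc (s + suc r) C suc s                          ∎
    where open ≡.≡-Reasoning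

module UniversalParametrization {c ℓ} (F : Field c ℓ) where
  open import Data.Fin using (splitAt; _↑ˡ_; _↑ʳ_; combine; remQuot)
  open import Data.Product using (uncurry)
  open import Data.Sum using ([_,_]′)
  open import Data.List using (List; []; _∷_)
  open import Data.List.Relation.Unary.All using (All; []; _∷_)
  open Field F
  open Expressions
  open ExpressionsInField F
  open MonomialEnumeration
  open import Algebra.Properties.Semiring.Sum semiring using (sum; sum-cong-≋; ∑-distrib-+)
  open SumFacts +-commutativeMonoid using (sum-zero; sum-single)
  open import Relation.Binary.Reasoning.Setoid setoid

  powE : ∀ {V} → Expr V → ℕ → Expr V
  powE x zero    = con 1ℤ
  powE x (suc n) = x ⊗ powE x n

  monomialE : ∀ {V s} → (Fin s → ℕ) → (Fin s → Fin V) → Expr V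
  monomialE {s = zero}  e xs = con 1ℤ
  monomialE {s = suc s} e xs = powE (var (xs Fin.zero)) (e Fin.zero) ⊗ monomialE (e ∘ Fin.suc) (xs ∘ Fin.suc)

  degree-monomialE : ∀ {V s} (e : Fin s → ℕ) (xs : Fin s → Fin V) → degree (monomialE e xs) ≡ totalDeg e
  degree-monomialE {s = zero}  e xs = ≡.refl
  degree-monomialE {s = suc s} e xs =
    ≡.cong₂ ℕ._+_ (degree-powE (e Fin.zero)) (degree-monomialE (e ∘ Fin.suc) (xs ∘ Fin.suc))
    where
    degree-powE : ∀ n → degree (powE (var (xs Fin.zero)) n) ≡ n
    degree-powE zero    = ≡.refl
    degree-powE (suc n) = ≡.cong suc (degree-powE n)

  ⟦monomialE⟧ : ∀ {V s} (e : Fin s → ℕ) (xs : Fin s → Fin V) ρ (w : Fin s → Carrier) →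
    (∀ i → ρ (xs i) ≈ w i) → ⟦ monomialE e xs ⟧ ρ ≈ monomial F e w
  ⟦monomialE⟧ {s = zero}  e xs ρ w ρ≈w = +-identityʳ 1#
  ⟦monomialE⟧ {s = suc s} e xs ρ w ρ≈w =
    *-cong (⟦powE⟧ (e Fin.zero)) (⟦monomialE⟧ (e ∘ Fin.suc) (xs ∘ Fin.suc) ρ (w ∘ Fin.suc) (ρ≈w ∘ Fin.suc))
    where
    ⟦powE⟧ : ∀ n → ⟦ powE (var (xs Fin.zero)) n ⟧ ρ ≈ pow F (w Fin.zero) n
    ⟦powE⟧ zero    = +-identityʳ 1#
    ⟦powE⟧ (suc n) = *-cong (ρ≈w Fin.zero) (⟦powE⟧ n)

  monomial-cong : ∀ {s} {e e′ : Fin s → ℕ} (w : Fin s → Carrier) → e ≗ e′ → monomial F e w ≡ monomial F e′ w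
  monomial-cong {zero}  w e≗e′ = ≡.refl
  monomial-cong {suc s} w e≗e′ =
    ≡.cong₂ _*_ (≡.cong (pow F (w Fin.zero)) (e≗e′ Fin.zero)) (monomial-cong (w ∘ Fin.suc) (e≗e′ ∘ Fin.suc))

  module Regrouping (s r : ℕ) where

    single : ∀ {n} → Carrier → Fin n → Fin n → Carrier
    single a j i with j FinP.≟ i
    ... | yes _ = a
    ... | no _  = 0#

    coefficients : (ts : List (Term F s)) → All (λ t → totalDeg (proj₂ t) ℕ.≤ r) ts → Fin (count s r) → Carrier
    coefficients []             []       i = 0#
    coefficients ((a , e) ∷ ts) (d ∷ ds) i = single a (proj₁ (monomials-complete s r e d)) i + coefficients ts ds i

    term-by-coefficients : ∀ a e (d : totalDeg e ℕ.≤ r) x →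
      a * monomial F e x ≈ sum (λ i → single a (proj₁ (monomials-complete s r e d)) i * monomial F (monomials s r i) x)
    term-by-coefficients a e d x = sym (trans (sum-single _ j others-vanish) at-j)
      where
      j : Fin (count s r)
      j = proj₁ (monomials-complete s r e d)
      others-vanish : ∀ i → i ≢ j → single a j i * monomial F (monomials s r i) x ≈ 0#
      others-vanish i i≢j with j FinP.≟ i
      ... | yes j≡i = contradiction (≡.sym j≡i) i≢j
      ... | no _    = zeroˡ _
      at-j : single a j j * monomial F (monomials s r j) x ≈ a * monomial F e x
      at-j with j FinP.≟ j
      ... | yes _  = *-congˡ (reflexive (monomial-cong x (proj₂ (monomials-complete s r e d))))
      ... | no j≢j = contradiction ≡.refl j≢j

    by-coefficients : ∀ ts ds x →
      evalTerms F ts x ≈ sum (λ i → coefficients ts ds i * monomial F (monomials s r i) x)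
    by-coefficients []             []       x = sym (sum-zero (λ i → 0# * monomial F (monomials s r i) x) (λ i → zeroˡ _))
    by-coefficients ((a , e) ∷ ts) (d ∷ ds) x = begin
        a * monomial F e x + evalTerms F ts x
      ≈⟨ +-cong (term-by-coefficients a e d x) (by-coefficients ts ds x) ⟩
        sum (λ i → single a j i * mon i) + sum (λ i → coefficients ts ds i * mon i)
      ≈⟨ ∑-distrib-+ (λ i → single a j i * mon i) (λ i → coefficients ts ds i * mon i) ⟨
        sum (λ i → single a j i * mon i + coefficients ts ds i * mon i)
      ≈⟨ sum-cong-≋ (λ i → distribʳ (mon i) _ _) ⟨
        sum (λ i → coefficients ((a , e) ∷ ts) (d ∷ ds) i * mon i)
      ∎
      where
      j : Fin (count s r)
      j = proj₁ (monomials-complete s r e d)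
      mon : Fin (count s r) → Carrier
      mon i = monomial F (monomials s r i) x

  module Universal (r s m K : ℕ) where
    open Regrouping s r using (coefficients; by-coefficients)

    μ : ℕ
    μ = count s r

    -- the parameters: m μ coefficients followed by K s preimage coordinates
    Parameters : ℕ
    Parameters = m ℕ.* μ ℕ.+ K ℕ.* s

    coefficientVar : Fin m → Fin μ → Fin Parameters
    coefficientVar j i = combine j i ↑ˡ K ℕ.* s

    pointVar : Fin K → Fin s → Fin Parameters
    pointVar k i = m ℕ.* μ ↑ʳ combine k i

    component : Fin K → Fin m → Expr Parameters
    component k j = sumE (λ i → var (coefficientVar j i) ⊗ monomialE (monomials s r i) (pointVar k))

    Φ : Fin (K ℕ.* m) → Expr Parameters
    Φ p = uncurry component (remQuot m p)

    -- a coefficient times a monomial of degree ≤ r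
    degree-Φ : ∀ p → degree (Φ p) ℕ.≤ suc r
    degree-Φ p = degree-sumE _ λ i → ℕ.s≤s (ℕP.≤-trans
      (ℕP.≤-reflexive (degree-monomialE (monomials s r i) (pointVar (proj₁ (remQuot m p)))))
      (monomials-degree s r i))

    parameters : (Fin m → Fin μ → Carrier) → (Fin K → Fin s → Carrier) → Fin Parameters → Carrier
    parameters c x v = [ uncurry c ∘ remQuot μ , uncurry x ∘ remQuot s ]′ (splitAt (m ℕ.* μ) v)

    parameters-coefficient : ∀ c x j i → parameters c x (coefficientVar j i) ≡ c j i
    parameters-coefficient c x j i = ≡.trans
      (≡.cong [ uncurry c ∘ remQuot μ , uncurry x ∘ remQuot s ]′ (FinP.splitAt-↑ˡ (m ℕ.* μ) (combine j i) (K ℕ.* s)))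
      (≡.cong (uncurry c) (FinP.remQuot-combine j i))

    parameters-point : ∀ c x k i → parameters c x (pointVar k i) ≡ x k i
    parameters-point c x k i = ≡.trans
      (≡.cong [ uncurry c ∘ remQuot μ , uncurry x ∘ remQuot s ]′ (FinP.splitAt-↑ʳ (m ℕ.* μ) (K ℕ.* s) (combine k i)))
      (≡.cong (uncurry x) (FinP.remQuot-combine k i))

    flatten : (Fin K → Fin m → Carrier) → Fin (K ℕ.* m) → Carrier
    flatten P p = uncurry P (remQuot m p)

    flatten-unflatten : (z : Fin (K ℕ.* m) → Carrier) → flatten (λ k j → z (combine k j)) ≗ z
    flatten-unflatten z p = ≡.cong z (FinP.combine-remQuot {K} m p)

    parametrize : (Γ : PolyMap F s r m) (P : Fin K → Fin m → Carrier) → (∀ k → InImage F Γ (P k)) →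
      ∃ λ y → ∀ p → ⟦ Φ p ⟧ y ≈ flatten P p
    parametrize Γ P inImage = y , λ p → component-value (proj₁ (remQuot {K} m p)) (proj₂ (remQuot {K} m p))
      where
      x : Fin K → Fin s → Carrier
      x k = proj₁ (inImage k)
      coeffs : Fin m → Fin μ → Carrier
      coeffs j = coefficients (Poly.terms (Γ j)) (Poly.degree (Γ j))
      y : Fin Parameters → Carrier
      y = parameters coeffs x
      component-value : ∀ k j → ⟦ component k j ⟧ y ≈ P k j
      component-value k j = begin
          ⟦ component k j ⟧ y
        ≈⟨ ⟦sumE⟧ (λ i → var (coefficientVar j i) ⊗ monomialE (monomials s r i) (pointVar k)) y ⟩
          sum (λ i → y (coefficientVar j i) * ⟦ monomialE (monomials s r i) (pointVar k) ⟧ y)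
        ≈⟨ sum-cong-≋ (λ i → *-cong (reflexive (parameters-coefficient coeffs x j i))
             (⟦monomialE⟧ (monomials s r i) (pointVar k) y (x k) (reflexive ∘ parameters-point coeffs x k))) ⟩
          sum (λ i → coeffs j i * monomial F (monomials s r i) (x k))
        ≈⟨ by-coefficients (Poly.terms (Γ j)) (Poly.degree (Γ j)) (x k) ⟨
          eval F (Γ j) (x k)
        ≈⟨ proj₂ (inImage k) j ⟩
          P k j
        ∎

open import Data.Nat using (_+_; _*_; _∸_; _≤_; _<_)
open import Data.Nat.Combinatorics using (_C_)
open import Data.Fin using (combine)

lemma6p5 : ∀ {c ℓ : Level} (F : Field c ℓ) → CharZero F →
    (r s m K : ℕ) → 1 ≤ r → 1 ≤ s → s < m →
    m * ((s + r) C s) + 1 ≤ K * (m ∸ s) →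
    Σ (Fin K → Fin m → Field.Carrier F) (λ P → Elusive F s r P)
lemma6p5 F char0 r s m K _ _ s<m hyp = points , elusive
  where
  open Field F using (Carrier; trans; reflexive)
  open UnivariatePolynomials F using (point)
  open UniversalParametrization F
  open Universal r s m K
  open DimensionCounting F char0

  fewer-parameters : Parameters < K * m
  fewer-parameters = Counting.parameters<coordinates m s K μ s<m
    (≡.subst (λ n → m * n + 1 ≤ K * (m ∸ s)) (≡.sym (MonomialEnumeration.count≡binomial s r)) hyp)

  A : Annihilator Φ
  A = annihilator (suc r) Φ degree-Φ fewer-parameters
  open Annihilator A using (β)

  points : Fin K → Fin m → Carrier
  points k j = point (β (combine k j))

  elusive : Elusive F s r points
  elusive Γ inImage = let (y , Φy≈points) = parametrize Γ points inImage in
    not-in-image A y λ p → trans (Φy≈points p) (reflexive (flatten-unflatten (point ∘ β) p))
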